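{- Let $\alpha\ge 5/3$. Let $G$ be an instance of MAP that is 2-node connected, and let $e=uv$ be a unit-cost S2 of $G$. Let $\hat v$ be the contracted node of $G/\{u,v\}$, and let $B_1,\dots,B_k$ be the 2ec-$\hat v$-blocks of $G/\{u,v\}$. Let $B'_1,\dots,B'_k$ be 2-ECSSs of $B_1,\dots,B_k$, respectively, with $\mathrm{cost}(B'_i)\le\max(\mathrm{opt}(B_i),\ \alpha\,\mathrm{opt}(B_i)-2)$ for all $i\in[k]$. Then there exists an edge $f$ of $G$ such that $\{e,f\}\cup E(B'_1)\cup\dots\cup E(B'_k)$ is the edge set of a 2-ECSS of $G$ of cost at most $\max(\mathrm{opt}(G),\ \alpha\,\mathrm{opt}(G)-2)$.
   Context: An instance of MAP is a loop-free, 2-edge connected multigraph $G$ with edge costs in $\{0,1\}$ whose cost-$0$ edges ("zero-edges") form a matching; cost-$1$ edges are unit-edges. A graph is 2-edge connected if it has at least $2$ nodes and is connected after deleting any single edge. It is 2-node connected if it has at least $3$ nodes and is connected after deleting any single node. A 2-ECSS is a 2-edge connected spanning subgraph, and $\mathrm{opt}(\cdot)$ is its minimum cost. $G/\{u,v\}$ identifies $u$ and $v$ into one node $\hat v$ and deletes $uv$ and its parallel copies; its edges are identified with those of $G$. For a cut node $w$ of a 2-edge connected graph $M$, a 2ec-$w$-block is the subgraph induced by $\{w\}\cup V(C)$ for a component $C$ of $M-w$. A unit-cost S2 of $G$ is a unit-edge $uv$ such that $G-\{u,v\}$ has at least $2$ connected components and, in $G/\{u,v\}$, there exist two distinct 2ec-$\hat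 v$-blocks $B_1,B_2$ such that for each $i\in\{1,2\}$, $\mathrm{opt}(B_i)\ge3$ and $B_i$ has a zero-edge incident to $\hat v$.
   Formalization: The parameter α is rational rather than real. -}

module Defs where

open import Data.Nat using (ℕ; zero; suc; _+_; _≤_)
open import Data.Bool using (Bool; true; false; _∧_; _∨_; not; if_then_else_)
open import Data.Fin using (Fin; zero; suc; _≟_)
open import Data.Product using (_×_; _,_; proj₁; proj₂; Σ; ∃; ∃-syntax)
open import Data.Sum using (_⊎_)
open import Relation.Nullary using (¬_)
open import Relation.Nullary.Decidable using (⌊_⌋)
open import Relation.Binary.PropositionalEquality using (_≡_; _≢_)
open import Relation.Binary.Construct.Closure.ReflexiveTransitive using (Star)
open import Data.Integer using (+_)
import Data.Rational as ℚ
open ℚ using (ℚ)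

_==_ : ∀ {n} → Fin n → Fin n → Bool
x == y = ⌊ x ≟ y ⌋

sumFin : ∀ {m} → (Fin m → ℕ) → ℕ
sumFin {zero}  f = 0
sumFin {suc m} f = f zero + sumFin (λ i → f (suc i))

anyFin : ∀ {k} → (Fin k → Bool) → Bool
anyFin {zero}  f = false
anyFin {suc k} f = f zero ∨ anyFin (λ i → f (suc i))

toℚ : ℕ → ℚ
toℚ n = (+ n) ℚ./ 1

-- Multigraphs on the ambient node set Fin n and ambient edge set Fin m.
-- A "view" selects a node set V, an edge set E and an endpoint map
-- (the endpoint map is changed by contraction).  Edges of a view are
-- identified with ambient edges (indices in Fin m).

record View (n m : ℕ) : Set where
  field
    V    : Fin n → Bool
    E    : Fin m → Bool
    ends : Fin m → Fin n × Fin n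
open View public

data Step {n m : ℕ} (ends : Fin m → Fin n × Fin n)
          (W : Fin n → Bool) (F : Fin m → Bool) : Fin n → Fin n → Set where
  fwd : ∀ e → F e ≡ true → W (proj₁ (ends e)) ≡ true → W (proj₂ (ends e)) ≡ true →
        Step ends W F (proj₁ (ends e)) (proj₂ (ends e))
  bwd : ∀ e → F e ≡ true → W (proj₁ (ends e)) ≡ true → W (proj₂ (ends e)) ≡ true →
        Step ends W F (proj₂ (ends e)) (proj₁ (ends e))

Reach : ∀ {n m} → (Fin m → Fin n × Fin n) → (Fin n → Bool) → (Fin m → Bool) →
        Fin n → Fin n → Set
Reach ends W F = Star (Step ends W F)

Connected : ∀ {n m} → (Fin m → Fin n × Fin n) → (Fin n → Bool) → (Fin m → Bool) → Set
Connected ends W F = ∀ x y → W x ≡ true → W y ≡ true → Reach ends W F x y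

AtLeast2 : ∀ {n} → (Fin n → Bool) → Set
AtLeast2 W = ∃[ x ] ∃[ y ] (x ≢ y × W x ≡ true × W y ≡ true)

AtLeast3 : ∀ {n} → (Fin n → Bool) → Set
AtLeast3 W = ∃[ x ] ∃[ y ] ∃[ z ]
  (x ≢ y × x ≢ z × y ≢ z × W x ≡ true × W y ≡ true × W z ≡ true)

delE : ∀ {m} → (Fin m → Bool) → Fin m → (Fin m → Bool)
delE F e e' = F e' ∧ not (e' == e)

delV : ∀ {n} → (Fin n → Bool) → Fin n → (Fin n → Bool)
delV W w x = W x ∧ not (x == w)

TwoEC : ∀ {n m} → (Fin m → Fin n × Fin n) → (Fin n → Bool) → (Fin m → Bool) → Set
TwoEC ends W F = AtLeast2 W × Connected ends W F
               × (∀ e → F e ≡ true → Connected ends W (delE F e))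

TwoNC : ∀ {n m} → (Fin m → Fin n × Fin n) → (Fin n → Bool) → (Fin m → Bool) → Set
TwoNC ends W F = AtLeast3 W × Connected ends W F
               × (∀ w → W w ≡ true → Connected ends (delV W w) F)

TwoECView : ∀ {n m} → View n m → Set
TwoECView M = TwoEC (ends M) (V M) (E M)

cost : ∀ {m} → (Fin m → ℕ) → (Fin m → Bool) → ℕ
cost c S = sumFin (λ e → if S e then c e else 0)

IsECSS : ∀ {n m} → View n m → (Fin m → Bool) → Set
IsECSS M S = (∀ e → S e ≡ true → E M e ≡ true) × TwoEC (ends M) (V M) S

IsOpt : ∀ {n m} → (Fin m → ℕ) → View n m → ℕ → Set
IsOpt c M o = (∃[ S ] (IsECSS M S × cost c S ≡ o))
            × (∀ S → IsECSS M S → o ≤ cost c S)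

whole : ∀ {n m} → (Fin m → Fin n × Fin n) → View n m
whole ends = record { V = λ _ → true ; E = λ _ → true ; ends = ends }

record IsMAP {n m : ℕ} (ends : Fin m → Fin n × Fin n) (c : Fin m → ℕ) : Set where
  field
    loopFree  : ∀ e → proj₁ (ends e) ≢ proj₂ (ends e)
    costs01   : ∀ e → (c e ≡ 0) ⊎ (c e ≡ 1)
    zeroMatch : ∀ e e' → c e ≡ 0 → c e' ≡ 0 → e ≢ e' →
                (proj₁ (ends e) ≢ proj₁ (ends e')) × (proj₁ (ends e) ≢ proj₂ (ends e'))
              × (proj₂ (ends e) ≢ proj₁ (ends e')) × (proj₂ (ends e) ≢ proj₂ (ends e'))
    twoEC     : TwoECView (whole ends)

-- Contraction G/{u,v}: u is identified with v (so the new node v̂ is v),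
-- and all edges with endpoint set {u,v} (uv and its parallel copies) are
-- deleted.  Edges keep their indices (identified with those of G).

isUV : ∀ {n} → Fin n → Fin n → Fin n × Fin n → Bool
isUV u v (a , b) = ((a == u) ∧ (b == v)) ∨ ((a == v) ∧ (b == u))

contract : ∀ {n m} → (Fin m → Fin n × Fin n) → Fin n → Fin n → View n m
contract ends u v = record
  { V    = λ x → not (x == u)
  ; E    = λ e → not (isUV u v (ends e))
  ; ends = λ e → φ (proj₁ (ends e)) , φ (proj₂ (ends e))
  }
  where
  φ : _ → _
  φ x = if x == u then v else x

IsComponent : ∀ {n m} → View n m → Fin n → (Fin n → Bool) → Set
IsComponent M w C =
  ∃[ r ] (delV (V M) w r ≡ true ×
          (∀ x → (C x ≡ true → Reach (ends M) (delV (V M) w) (E M) r x)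
               × (Reach (ends M) (delV (V M) w) (E M) r x → C x ≡ true)))

IsComponentDel : ∀ {n m} → View n m → (Fin n → Bool) → (Fin n → Bool) → Set
IsComponentDel M D C =
  ∃[ r ] (W r ≡ true ×
          (∀ x → (C x ≡ true → Reach (ends M) W (E M) r x)
               × (Reach (ends M) W (E M) r x → C x ≡ true)))
  where
  W : _ → Bool
  W x = V M x ∧ not (D x)

induced : ∀ {n m} → View n m → (Fin n → Bool) → View n m
induced M W = record
  { V    = λ x → V M x ∧ W x
  ; E    = λ e → E M e ∧ W (proj₁ (ends M e)) ∧ W (proj₂ (ends M e))
  ; ends = ends M
  }

block : ∀ {n m} → View n m → Fin n → (Fin n → Bool) → View n m
block M w C = induced M (λ x → (x == w) ∨ C x)

HasZeroEdgeAt : ∀ {n m} → (Fin m → ℕ) → View n m → Fin n → Set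
HasZeroEdgeAt c B w = ∃[ f ] (E B f ≡ true × c f ≡ 0 ×
  ((proj₁ (ends B f) ≡ w) ⊎ (proj₂ (ends B f) ≡ w)))

IsUnitS2 : ∀ {n m} → (Fin m → Fin n × Fin n) → (Fin m → ℕ) → Fin m → Set
IsUnitS2 {n} ends c e =
  c e ≡ 1
  × (∃[ C₁ ] ∃[ C₂ ] (IsComponentDel (whole ends) uv C₁ × IsComponentDel (whole ends) uv C₂
                      × ∃[ x ] (C₁ x ≢ C₂ x)))
  × (∃[ C₁ ] ∃[ C₂ ] (IsComponent M v C₁ × IsComponent M v C₂ × ∃[ x ] (C₁ x ≢ C₂ x)
                      × Good C₁ × Good C₂))
  where
  u v : Fin n
  u = proj₁ (ends e)
  v = proj₂ (ends e)
  uv : Fin n → Bool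
  uv x = (x == u) ∨ (x == v)
  M = contract ends u v
  Good : (Fin n → Bool) → Set
  Good C = (∃[ o ] (IsOpt c (block M v C) o × 3 ≤ o)) × HasZeroEdgeAt c (block M v C) v

WithinBound : ℚ → ℕ → ℕ → Set
WithinBound α cst o = toℚ cst ℚ.≤ (toℚ o ℚ.⊔ ((α ℚ.* toℚ o) ℚ.- toℚ 2))

module Submission where

-- Let U be the union of the B′ᵢ. Every node of G - u lies in some block, so with e every node reaches v in
-- U - g for each edge g ≠ e. To survive the deletion of e itself: every node reaches u or v in U (lifting the
-- block paths without e), so either U already joins v to u, or, since G - e is connected, some edge f leaves
-- the set of nodes joined to u in U, and then v reaches u through f. Hence {e, f} ∪ U is a 2-ECSS of G, of
-- cost at most 2 + Σ cost(B′ᵢ).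
-- Conversely a 2-ECSS of G restricts to a 2-ECSS of every block, and the blocks are edge-disjoint, so
-- opt(G) ≥ Σ opt(Bᵢ). For o ≥ 3 and α ≥ 5/3 we have o + 2 ≤ α o, so each of the two blocks with opt ≥ 3
-- leaves a slack of 2 in its bound; together they pay for e and f, and cost ≤ α opt(G) - 2.
-- Constructively the optima of the blocks exist only under double negation, which suffices because the
-- inequality to be proved is a decidable one between rationals.

open import Defs
open import Data.Nat using (ℕ; zero; suc; _+_)
import Data.Nat as ℕ
import Data.Nat.Properties as ℕ
open import Data.Bool using (Bool; true; false; _∧_; _∨_; not; if_then_else_)
open import Data.Bool.Properties using () renaming (_≟_ to _≟ᵇ_)
open import Data.Fin using (Fin; zero; suc; _≟_)
open import Data.Fin.Properties using (any?; suc-injective)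
open import Data.Product using (_×_; _,_; proj₁; proj₂; ∃-syntax)
open import Data.Sum using (_⊎_; inj₁; inj₂)
open import Data.Empty using (⊥; ⊥-elim)
open import Relation.Nullary using (¬_; Dec; yes; no; ¬¬-excluded-middle; contradiction)
open import Relation.Nullary.Decidable using (⌊_⌋; _×-dec_; _⊎-dec_)
open import Relation.Binary.PropositionalEquality
  using (_≡_; _≢_; refl; sym; trans; cong; cong₂; subst; subst₂; module ≡-Reasoning)
open import Relation.Binary.Construct.Closure.ReflexiveTransitive as Star using (ε; _◅_; _◅◅_)

==-refl : ∀ {n} (x : Fin n) → (x == x) ≡ true
==-refl x with x ≟ x
... | yes _   = refl
... | no x≢x = ⊥-elim (x≢x refl)

==-false : ∀ {n} {x y : Fin n} → x ≢ y → (x == y) ≡ false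
==-false {x = x} {y} x≢y with x ≟ y
... | yes x≡y = ⊥-elim (x≢y x≡y)
... | no _    = refl

==⇒≡ : ∀ {n} {x y : Fin n} → (x == y) ≡ true → x ≡ y
==⇒≡ {x = x} {y} h with x ≟ y
... | yes x≡y = x≡y

∧-elimˡ : ∀ {a b} → (a ∧ b) ≡ true → a ≡ true
∧-elimˡ {true} _ = refl

∧-elimʳ : ∀ {a b} → (a ∧ b) ≡ true → b ≡ true
∧-elimʳ {true} h = h

∧-intro : ∀ {a b} → a ≡ true → b ≡ true → (a ∧ b) ≡ true
∧-intro refl refl = refl

∨-introˡ : ∀ {a} b → a ≡ true → (a ∨ b) ≡ true
∨-introˡ b refl = refl

∨-introʳ : ∀ a {b} → b ≡ true → (a ∨ b) ≡ true
∨-introʳ true  _    = refl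
∨-introʳ false refl = refl

∨-elim : ∀ {a b} → (a ∨ b) ≡ true → (a ≡ true) ⊎ (b ≡ true)
∨-elim {true}  _ = inj₁ refl
∨-elim {false} h = inj₂ h

not-intro : ∀ {a} → a ≡ false → not a ≡ true
not-intro refl = refl

not-elim : ∀ {a} → not a ≡ true → a ≡ false
not-elim {false} _ = refl

Bool-ext : ∀ {a b : Bool} → (a ≡ true → b ≡ true) → (b ≡ true → a ≡ true) → a ≡ b
Bool-ext {true}  f _ = sym (f refl)
Bool-ext {false} {true} _ g = g refl
Bool-ext {false} {false} _ _ = refl

_⊆_ : ∀ {A : Set} → (A → Bool) → (A → Bool) → Set
X ⊆ Y = ∀ x → X x ≡ true → Y x ≡ true

delV-intro : ∀ {n} {W : Fin n → Bool} {x w} → W w ≡ true → w ≢ x → delV W x w ≡ true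
delV-intro h w≢x = ∧-intro h (not-intro (==-false w≢x))

delV-⊆ : ∀ {n} (W : Fin n → Bool) x → delV W x ⊆ W
delV-⊆ W x w = ∧-elimˡ

delV-≢ : ∀ {n} {W : Fin n → Bool} {x w} → delV W x w ≡ true → w ≢ x
delV-≢ {W = W} {x} h refl with trans (sym (==-refl x)) (not-elim (∧-elimʳ {W x} h))
... | ()

delE-intro : ∀ {m} {F : Fin m → Bool} {e g} → F g ≡ true → g ≢ e → delE F e g ≡ true
delE-intro h g≢e = ∧-intro h (not-intro (==-false g≢e))

delE-⊆ : ∀ {m} (F : Fin m → Bool) e → delE F e ⊆ F
delE-⊆ F e g = ∧-elimˡ

delE-≢ : ∀ {m} {F : Fin m → Bool} {e g} → delE F e g ≡ true → g ≢ e
delE-≢ {F = F} {e} h refl with trans (sym (==-refl e)) (not-elim (∧-elimʳ {F e} h))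
... | ()

anyFin-elim : ∀ {k} (f : Fin k → Bool) → anyFin f ≡ true → ∃[ i ] (f i ≡ true)
anyFin-elim {suc k} f h with ∨-elim {f zero} h
... | inj₁ f₀ = zero , f₀
... | inj₂ rest with anyFin-elim (λ i → f (suc i)) rest
...   | i , fi = suc i , fi

anyFin-intro : ∀ {k} (f : Fin k → Bool) i → f i ≡ true → anyFin f ≡ true
anyFin-intro f zero    fi = ∨-introˡ _ fi
anyFin-intro f (suc i) fi = ∨-introʳ (f zero) (anyFin-intro (λ i → f (suc i)) i fi)

⌊⌋-sound : ∀ {P : Set} (d : Dec P) → ⌊ d ⌋ ≡ true → P
⌊⌋-sound (yes p) _ = p

⌊⌋-complete : ∀ {P : Set} (d : Dec P) → P → ⌊ d ⌋ ≡ true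
⌊⌋-complete (yes _) _ = refl
⌊⌋-complete (no ¬p) p = ⊥-elim (¬p p)

module Sums where

  open import Data.Nat using (_≤_; _<_; z≤n; s≤s)
  open import Algebra.Properties.CommutativeSemigroup ℕ.+-commutativeSemigroup
    using () renaming (interchange to +-interchange)

  sumFin-mono-≤ : ∀ {k} {f g : Fin k → ℕ} → (∀ i → f i ≤ g i) → sumFin f ≤ sumFin g
  sumFin-mono-≤ {zero}  h = z≤n
  sumFin-mono-≤ {suc k} h = ℕ.+-mono-≤ (h zero) (sumFin-mono-≤ (λ i → h (suc i)))

  sumFin-mono-< : ∀ {k} {f g : Fin k → ℕ} → (∀ i → f i ≤ g i) → ∀ j → f j < g j → sumFin f < sumFin g
  sumFin-mono-< h zero    lt = ℕ.+-mono-<-≤ lt (sumFin-mono-≤ (λ i → h (suc i)))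
  sumFin-mono-< h (suc j) lt = ℕ.+-mono-≤-< (h zero) (sumFin-mono-< (λ i → h (suc i)) j lt)

  size : ∀ {n} → (Fin n → Bool) → ℕ
  size = cost (λ _ → 1)

  size-delV : ∀ {n} (W : Fin n → Bool) x → W x ≡ true → size (delV W x) < size W
  size-delV W x Wx = sumFin-mono-< (λ y → shrink (W y)) x removed
    where
    shrink : ∀ a {b} → (if a ∧ b then 1 else 0) ≤ (if a then 1 else 0)
    shrink true  {true}  = ℕ.≤-refl
    shrink true  {false} = z≤n
    shrink false         = z≤n
    removed : (if delV W x x then 1 else 0) < (if W x then 1 else 0)
    removed rewrite Wx | ==-refl x = s≤s z≤n

  sumFin-+ : ∀ {k} (f g : Fin k → ℕ) → sumFin (λ i → f i + g i) ≡ sumFin f + sumFin g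
  sumFin-+ {zero}  f g = refl
  sumFin-+ {suc k} f g = begin
    (f zero + g zero) + sumFin (λ i → f (suc i) + g (suc i))
      ≡⟨ cong (f zero + g zero +_) (sumFin-+ (λ i → f (suc i)) (λ i → g (suc i))) ⟩
    (f zero + g zero) + (sumFin (λ i → f (suc i)) + sumFin (λ i → g (suc i)))
      ≡⟨ +-interchange (f zero) (g zero) _ _ ⟩
    (f zero + sumFin (λ i → f (suc i))) + (g zero + sumFin (λ i → g (suc i))) ∎
    where open ≡-Reasoning

  sumFin-zero : ∀ {k} (f : Fin k → ℕ) → (∀ i → f i ≡ 0) → sumFin f ≡ 0
  sumFin-zero {zero}  f f≡0 = refl
  sumFin-zero {suc k} f f≡0 rewrite f≡0 zero = sumFin-zero (λ i → f (suc i)) (λ i → f≡0 (suc i))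

  sumFin-swap : ∀ {k l} (h : Fin k → Fin l → ℕ) →
    sumFin (λ i → sumFin (λ j → h i j)) ≡ sumFin (λ j → sumFin (λ i → h i j))
  sumFin-swap {zero} {l} h = sym (sumFin-zero {l} (λ _ → 0) (λ _ → refl))
  sumFin-swap {suc k} h = begin
    sumFin (h zero) + sumFin (λ i → sumFin (h (suc i)))
      ≡⟨ cong (sumFin (h zero) +_) (sumFin-swap (λ i → h (suc i))) ⟩
    sumFin (h zero) + sumFin (λ j → sumFin (λ i → h (suc i) j))
      ≡⟨ sumFin-+ (h zero) (λ j → sumFin (λ i → h (suc i) j)) ⟨
    sumFin (λ j → h zero j + sumFin (λ i → h (suc i) j)) ∎
    where open ≡-Reasoning

  sumFin-support : ∀ {k} (f : Fin k → ℕ) j → (∀ i → i ≢ j → f i ≡ 0) → sumFin f ≡ f j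
  sumFin-support f zero f≡0
    rewrite sumFin-zero (λ i → f (suc i)) (λ i → f≡0 (suc i) (λ ())) = ℕ.+-identityʳ (f zero)
  sumFin-support f (suc j) f≡0
    rewrite f≡0 zero (λ ()) = sumFin-support (λ i → f (suc i)) j (λ i i≢j → f≡0 (suc i) (λ eq → i≢j (suc-injective eq)))

  sumFin-≥-single : ∀ {k} (f : Fin k → ℕ) i → f i ≤ sumFin f
  sumFin-≥-single f zero    = ℕ.m≤m+n _ _
  sumFin-≥-single f (suc i) = ℕ.≤-trans (sumFin-≥-single (λ j → f (suc j)) i) (ℕ.m≤n+m _ _)

  sumFin-≥-pair : ∀ {k} (f : Fin k → ℕ) i j → i ≢ j → f i + f j ≤ sumFin f
  sumFin-≥-pair f zero    zero    i≢j = ⊥-elim (i≢j refl)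
  sumFin-≥-pair f zero    (suc j) _   = ℕ.+-monoʳ-≤ (f zero) (sumFin-≥-single (λ j → f (suc j)) j)
  sumFin-≥-pair f (suc i) zero    _   =
    ℕ.≤-trans (ℕ.≤-reflexive (ℕ.+-comm (f (suc i)) (f zero))) (ℕ.+-monoʳ-≤ (f zero) (sumFin-≥-single (λ j → f (suc j)) i))
  sumFin-≥-pair f (suc i) (suc j) i≢j =
    ℕ.≤-trans (sumFin-≥-pair (λ j → f (suc j)) i j (λ eq → i≢j (cong suc eq))) (ℕ.m≤n+m _ _)

  module _ {m : ℕ} (c : Fin m → ℕ) where

    cost-∨ : ∀ (A B : Fin m → Bool) → cost c (λ g → A g ∨ B g) ≤ cost c A + cost c B
    cost-∨ A B = ℕ.≤-trans (sumFin-mono-≤ (λ g → pointwise (A g) (B g) (c g)))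
                           (ℕ.≤-reflexive (sumFin-+ (λ g → if A g then c g else 0) (λ g → if B g then c g else 0)))
      where
      pointwise : ∀ a b x → (if a ∨ b then x else 0) ≤ (if a then x else 0) + (if b then x else 0)
      pointwise true  b x = ℕ.m≤m+n x _
      pointwise false b x = ℕ.≤-refl

    cost-anyFin : ∀ {k} (B : Fin k → Fin m → Bool) →
      cost c (λ g → anyFin (λ i → B i g)) ≤ sumFin (λ i → cost c (B i))
    cost-anyFin B = ℕ.≤-trans (sumFin-mono-≤ (pointwise B))
                              (ℕ.≤-reflexive (sym (sumFin-swap (λ i g → if B i g then c g else 0))))
      where
      pointwise : ∀ {k} (B : Fin k → Fin m → Bool) g →
        (if anyFin (λ i → B i g) then c g else 0) ≤ sumFin (λ i → if B i g then c g else 0)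
      pointwise {zero}  B g = z≤n
      pointwise {suc k} B g with B zero g
      ... | true  = ℕ.m≤m+n _ _
      ... | false = pointwise (λ i → B (suc i)) g

    cost-singleton : ∀ h → cost c (_== h) ≤ c h
    cost-singleton h = ℕ.≤-reflexive (trans (sumFin-support _ h off) (cong (λ b → if b then c h else 0) (==-refl h)))
      where
      off : ∀ g → g ≢ h → (if g == h then c g else 0) ≡ 0
      off g g≢h rewrite ==-false g≢h = refl

    sumFin-cost-disjoint : ∀ {k} (H : Fin k → Fin m → Bool) (T : Fin m → Bool) → (∀ i → H i ⊆ T) →
      (∀ i j g → i ≢ j → H i g ≡ true → H j g ≡ true → ⊥) → sumFin (λ i → cost c (H i)) ≤ cost c T
    sumFin-cost-disjoint {k} H T H⊆T disjoint =
      ℕ.≤-trans (ℕ.≤-reflexive (sumFin-swap charge)) (sumFin-mono-≤ pointwise)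
      where
      charge : Fin k → Fin m → ℕ
      charge i g = if H i g then c g else 0

      only : ∀ {i} g → H i g ≡ true → ∀ j → j ≢ i → charge j g ≡ 0
      only g hi j j≢i with H j g in hj
      ... | true  = ⊥-elim (disjoint j _ g j≢i hj hi)
      ... | false = refl

      absent : ∀ g → ¬ (∃[ i ] (H i g ≡ true)) → ∀ j → charge j g ≡ 0
      absent g none j with H j g in hj
      ... | true  = ⊥-elim (none (j , hj))
      ... | false = refl

      pointwise : ∀ g → sumFin (λ i → charge i g) ≤ (if T g then c g else 0)
      pointwise g with any? (λ i → H i g ≟ᵇ true)
      ... | yes (i , hi) rewrite sumFin-support (λ j → charge j g) i (only g hi) | hi | H⊆T i g hi = ℕ.≤-refl
      ... | no none      rewrite sumFin-zero (λ j → charge j g) (absent g none) = z≤n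

open Sums

module Walks where

  open import Data.Nat using (_≤_; s≤s)

  EdgesWithin : ∀ {n m} → (Fin m → Fin n × Fin n) → (Fin n → Bool) → (Fin m → Bool) → (Fin m → Bool) → Set
  EdgesWithin ends W F F′ = ∀ g → F g ≡ true → W (proj₁ (ends g)) ≡ true → W (proj₂ (ends g)) ≡ true → F′ g ≡ true

  module _ {n m : ℕ} {ends : Fin m → Fin n × Fin n} where

    Step-inside : ∀ {W F x y} → Step ends W F x y → W x ≡ true × W y ≡ true
    Step-inside (fwd _ _ wx wy) = wx , wy
    Step-inside (bwd _ _ wy wx) = wx , wy

    Step-sym : ∀ {W F x y} → Step ends W F x y → Step ends W F y x
    Step-sym (fwd g f wx wy) = bwd g f wx wy
    Step-sym (bwd g f wy wx) = fwd g f wy wx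

    Reach-sym : ∀ {W F x y} → Reach ends W F x y → Reach ends W F y x
    Reach-sym = Star.reverse Step-sym

    Reach-inside : ∀ {W F x y} → Reach ends W F x y → W x ≡ true → W y ≡ true
    Reach-inside ε       wx = wx
    Reach-inside (s ◅ p) _  = Reach-inside p (proj₂ (Step-inside s))

    Step-mono : ∀ {W F W′ F′ x y} → W ⊆ W′ → EdgesWithin ends W F F′ → Step ends W F x y → Step ends W′ F′ x y
    Step-mono W⊆ F⊆ (fwd g f wx wy) = fwd g (F⊆ g f wx wy) (W⊆ _ wx) (W⊆ _ wy)
    Step-mono W⊆ F⊆ (bwd g f wy wx) = bwd g (F⊆ g f wy wx) (W⊆ _ wy) (W⊆ _ wx)

    Reach-mono : ∀ {W F W′ F′ x y} → W ⊆ W′ → EdgesWithin ends W F F′ → Reach ends W F x y → Reach ends W′ F′ x y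
    Reach-mono W⊆ F⊆ = Star.map (Step-mono W⊆ F⊆)

    Step-within : ∀ {W F W′ F′ x y} → F ⊆ F′ → W′ x ≡ true → W′ y ≡ true → Step ends W F x y → Step ends W′ F′ x y
    Step-within F⊆ wx wy (fwd g f _ _) = fwd g (F⊆ g f) wx wy
    Step-within F⊆ wx wy (bwd g f _ _) = bwd g (F⊆ g f) wy wx

    Reach-monoᴱ : ∀ {W F F′ x y} → F ⊆ F′ → Reach ends W F x y → Reach ends W F′ x y
    Reach-monoᴱ F⊆ = Reach-mono (λ _ w → w) (λ g f _ _ → F⊆ g f)

    Step-avoid : ∀ {W F x a b} → a ≢ x → b ≢ x → Step ends W F a b → Step ends (delV W x) F a b
    Step-avoid {W} a≢x b≢x (fwd g f wa wb) = fwd g f (delV-intro {W = W} wa a≢x) (delV-intro {W = W} wb b≢x)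
    Step-avoid {W} a≢x b≢x (bwd g f wb wa) = bwd g f (delV-intro {W = W} wb b≢x) (delV-intro {W = W} wa a≢x)

    Reach-lastVisit : ∀ {W F x a y} → y ≢ x → Reach ends W F a y →
      (a ≢ x × Reach ends (delV W x) F a y) ⊎ ∃[ z ] (Step ends W F x z × Reach ends (delV W x) F z y)
    Reach-lastVisit y≢x ε = inj₁ (y≢x , ε)
    Reach-lastVisit {x = x} {a} y≢x (s ◅ p) with Reach-lastVisit y≢x p
    ... | inj₂ later = inj₂ later
    ... | inj₁ (b≢x , q) with a ≟ x
    ...   | yes refl = inj₂ (_ , s , q)
    ...   | no a≢x   = inj₁ (a≢x , Step-avoid a≢x b≢x s ◅ q)

  module _ {n m : ℕ} (ends : Fin m → Fin n × Fin n) where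

    LeavesVia : (W : Fin n → Bool) (F : Fin m → Bool) (x y : Fin n) → Fin m → Set
    LeavesVia W F x y g = F g ≡ true × W (proj₁ (ends g)) ≡ true × W (proj₂ (ends g)) ≡ true
      × ((proj₁ (ends g) ≡ x × Reach ends (delV W x) F (proj₂ (ends g)) y)
         ⊎ (proj₂ (ends g) ≡ x × Reach ends (delV W x) F (proj₁ (ends g)) y))

    LeavesVia-sound : ∀ {W F x y} g → LeavesVia W F x y g → Reach ends W F x y
    LeavesVia-sound {W} g (f , w₁ , w₂ , inj₁ (refl , p)) = fwd g f w₁ w₂ ◅ Reach-mono (delV-⊆ W _) (λ g f _ _ → f) p
    LeavesVia-sound {W} g (f , w₁ , w₂ , inj₂ (refl , p)) = bwd g f w₁ w₂ ◅ Reach-mono (delV-⊆ W _) (λ g f _ _ → f) p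

    LeavesVia-complete : ∀ {W F x z y} → Step ends W F x z → Reach ends (delV W x) F z y → ∃[ g ] LeavesVia W F x y g
    LeavesVia-complete (fwd g f w₁ w₂) p = g , f , w₁ , w₂ , inj₁ (refl , p)
    LeavesVia-complete (bwd g f w₁ w₂) p = g , f , w₁ , w₂ , inj₂ (refl , p)

    -- Recursion on the number of nodes: a path leaving x never needs to return to it.
    Reach?′ : ∀ k (W : Fin n → Bool) (F : Fin m → Bool) → size W ≤ k → ∀ x y → Dec (Reach ends W F x y)
    Reach?′ k W F bound x y with x ≟ y
    ... | yes refl = yes ε
    ... | no x≢y with W x ≟ᵇ true
    ...   | no ¬wx = no λ p → ¬wx (start∈W p)
      where
      start∈W : Reach ends W F x y → W x ≡ true
      start∈W ε       = ⊥-elim (x≢y refl)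
      start∈W (s ◅ _) = proj₁ (Step-inside s)
    ...   | yes wx with k | ℕ.<-≤-trans (size-delV W x wx) bound
    ...     | suc k′ | s≤s bound′ with any? (λ g → LeavesVia? g)
      where
      Reach?″ : ∀ z → Dec (Reach ends (delV W x) F z y)
      Reach?″ z = Reach?′ k′ (delV W x) F bound′ z y
      LeavesVia? : ∀ g → Dec (LeavesVia W F x y g)
      LeavesVia? g = (F g ≟ᵇ true) ×-dec (W (proj₁ (ends g)) ≟ᵇ true) ×-dec (W (proj₂ (ends g)) ≟ᵇ true)
        ×-dec (((proj₁ (ends g) ≟ x) ×-dec Reach?″ (proj₂ (ends g))) ⊎-dec ((proj₂ (ends g) ≟ x) ×-dec Reach?″ (proj₁ (ends g))))
    ...       | yes (g , via) = yes (LeavesVia-sound g via)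
    ...       | no ¬via = no λ p → case (Reach-lastVisit (λ y≡x → x≢y (sym y≡x)) p)
      where
      case : _ → ⊥
      case (inj₁ (x≢x , _))    = x≢x refl
      case (inj₂ (_ , s , q)) = ¬via (LeavesVia-complete s q)

    Reach? : ∀ W F x y → Dec (Reach ends W F x y)
    Reach? W F = Reach?′ (size W) W F ℕ.≤-refl

  Connected-hub : ∀ {n m} {ends : Fin m → Fin n × Fin n} {W F} h →
    (∀ x → W x ≡ true → Reach ends W F x h) → Connected ends W F
  Connected-hub h toHub x y wx wy = toHub x wx ◅◅ Reach-sym (toHub y wy)

  TwoEC-delE-connected : ∀ {n m} {ends : Fin m → Fin n × Fin n} {W F} →
    TwoEC ends W F → ∀ g → Connected ends W (delE F g)
  TwoEC-delE-connected {F = F} (_ , connected , bridgeless) g with F g in g∈F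
  ... | true  = bridgeless g g∈F
  ... | false = λ x y wx wy → Reach-monoᴱ keep (connected x y wx wy)
    where
    keep : F ⊆ delE F g
    keep g′ g′∈F = delE-intro {F = F} g′∈F λ { refl → contradiction (trans (sym g′∈F) g∈F) λ () }

open Walks

module Optimum where

  open import Data.Nat using (_≤_; _<_)
  open import Data.Nat.Induction using (<-rec)

  Minimum : (ℕ → Set) → Set
  Minimum P = ∃[ t ] (P t × (∀ s → P s → t ≤ s))

  ¬¬-minimum : (P : ℕ → Set) → ∀ N → P N → ¬ ¬ Minimum P
  ¬¬-minimum P = <-rec (λ N → P N → ¬ ¬ Minimum P) step
    where
    step : ∀ N → (∀ {s} → s < N → P s → ¬ ¬ Minimum P) → P N → ¬ ¬ Minimum P
    step N below pN ¬min = ¬¬-excluded-middle {A = ∃[ s ] (s < N × P s)} λ where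
      (yes (s , s<N , ps)) → below s<N ps ¬min
      (no ¬below)          → ¬min (N , pN , λ s ps → ℕ.≮⇒≥ (λ s<N → ¬below (s , s<N , ps)))

  ¬¬-opt : ∀ {n m} (c : Fin m → ℕ) (M : View n m) S → IsECSS M S → ¬ ¬ (∃[ o ] IsOpt c M o)
  ¬¬-opt c M S isS ¬opt = ¬¬-minimum Achievable (cost c S) (S , isS , refl) λ where
      (o , (T , isT , cT) , least) → ¬opt (o , (T , isT , cT) , λ S′ isS′ → least (cost c S′) (S′ , isS′ , refl))
    where
    Achievable : ℕ → Set
    Achievable t = ∃[ S ] (IsECSS M S × cost c S ≡ t)

  ¬¬-Π-Fin : ∀ {k} (P : Fin k → Set) → (∀ i → ¬ ¬ P i) → ¬ ¬ (∀ i → P i)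
  ¬¬-Π-Fin {zero}  P _   ¬all = ¬all λ ()
  ¬¬-Π-Fin {suc k} P ¬¬P ¬all = ¬¬P zero λ p₀ → ¬¬-Π-Fin (λ i → P (suc i)) (λ i → ¬¬P (suc i)) λ ps →
    ¬all λ { zero → p₀ ; (suc i) → ps i }

open Optimum

module Bounds where

  open import Data.Bool.Properties using (∨-zeroʳ)
  open import Relation.Nullary.Decidable using (toWitness)
  open import Data.Integer as ℤ using (+_)
  import Data.Integer.Properties as ℤ
  open import Data.Rational as ℚ using (ℚ; _/_)
  import Data.Rational.Properties as ℚ
  import Data.Rational.Unnormalised as ℚᵘ
  import Data.Rational.Unnormalised.Properties as ℚᵘ
  open import Data.Rational.Solver using (module +-*-Solver)
  open +-*-Solver

  toℚᵘ-toℚ : ∀ n → ℚ.toℚᵘ (toℚ n) ℚᵘ.≃ ℚᵘ.mkℚᵘ (+ n) 0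
  toℚᵘ-toℚ n = ℚ.toℚᵘ-fromℚᵘ (ℚᵘ.mkℚᵘ (+ n) 0)

  toℚ-+ : ∀ a b → toℚ (a ℕ.+ b) ≡ toℚ a ℚ.+ toℚ b
  toℚ-+ a b = ℚ.toℚᵘ-injective (begin
    ℚ.toℚᵘ (toℚ (a ℕ.+ b))                 ≈⟨ toℚᵘ-toℚ (a ℕ.+ b) ⟩
    ℚᵘ.mkℚᵘ (+ (a ℕ.+ b)) 0                ≈⟨ ℚᵘ.*≡* (cong (ℤ._* + 1) (cong₂ ℤ._+_ (sym (ℤ.*-identityʳ (+ a))) (sym (ℤ.*-identityʳ (+ b))))) ⟩
    ℚᵘ.mkℚᵘ (+ a) 0 ℚᵘ.+ ℚᵘ.mkℚᵘ (+ b) 0   ≈⟨ ℚᵘ.+-cong (toℚᵘ-toℚ a) (toℚᵘ-toℚ b) ⟨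
    ℚ.toℚᵘ (toℚ a) ℚᵘ.+ ℚ.toℚᵘ (toℚ b)     ≈⟨ ℚ.toℚᵘ-homo-+ (toℚ a) (toℚ b) ⟨
    ℚ.toℚᵘ (toℚ a ℚ.+ toℚ b)               ∎)
    where open ℚᵘ.≃-Reasoning

  toℚ-mono-≤ : ∀ {a b} → a ℕ.≤ b → toℚ a ℚ.≤ toℚ b
  toℚ-mono-≤ {a} {b} a≤b = ℚ.toℚᵘ-cancel-≤
    (ℚᵘ.≤-respˡ-≃ (ℚᵘ.≃-sym (toℚᵘ-toℚ a)) (ℚᵘ.≤-respʳ-≃ (ℚᵘ.≃-sym (toℚᵘ-toℚ b))
      (ℚᵘ.*≤* (ℤ.*-monoʳ-≤-nonNeg (+ 1) (ℤ.+≤+ a≤b)))))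

  toℚ-nonNeg : ∀ n → ℚ.NonNegative (toℚ n)
  toℚ-nonNeg n = ℚ.normalize-nonNeg n 1

  +2≤⇒≤-2 : ∀ {x y} → x ℚ.+ toℚ 2 ℚ.≤ y → x ℚ.≤ y ℚ.- toℚ 2
  +2≤⇒≤-2 {x} {y} x+2≤y = ℚ.≤-trans (ℚ.≤-reflexive (sym cancel)) (ℚ.+-monoˡ-≤ (ℚ.- toℚ 2) x+2≤y)
    where
    cancel : (x ℚ.+ toℚ 2) ℚ.- toℚ 2 ≡ x
    cancel = solve 2 (λ x t → (x :+ t) :- t := x) refl x (toℚ 2)

  ≤-2⇒+2≤ : ∀ {x y} → x ℚ.≤ y ℚ.- toℚ 2 → x ℚ.+ toℚ 2 ℚ.≤ y
  ≤-2⇒+2≤ {x} {y} x≤y-2 = ℚ.≤-trans (ℚ.+-monoˡ-≤ (toℚ 2) x≤y-2) (ℚ.≤-reflexive cancel)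
    where
    cancel : (y ℚ.- toℚ 2) ℚ.+ toℚ 2 ≡ y
    cancel = solve 2 (λ y t → (y :- t) :+ t := y) refl y (toℚ 2)

  module _ (α : ℚ) (5/3≤α : (+ 5) / 3 ℚ.≤ α) where

    private instance
      α-nonNeg : ℚ.NonNegative α
      α-nonNeg = ℚ.nonNegative (ℚ.≤-trans (ℚ.nonNegative⁻¹ ((+ 5) / 3)) 5/3≤α)

    ≤α* : ∀ o → toℚ o ℚ.≤ α ℚ.* toℚ o
    ≤α* o = ℚ.≤-trans (ℚ.≤-reflexive (sym (ℚ.*-identityˡ (toℚ o))))
      (ℚ.*-monoʳ-≤-nonNeg (toℚ o) {{toℚ-nonNeg o}} (ℚ.≤-trans (toWitness {a? = ℚ.1ℚ ℚ.≤? ((+ 5) / 3)} _) 5/3≤α))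

    +2≤α* : ∀ o → 3 ℕ.≤ o → toℚ o ℚ.+ toℚ 2 ℚ.≤ α ℚ.* toℚ o
    +2≤α* o 3≤o = begin
      toℚ o ℚ.+ toℚ 2                      ≡⟨⟩
      toℚ o ℚ.+ ((+ 2) / 3) ℚ.* toℚ 3      ≤⟨ ℚ.+-monoʳ-≤ (toℚ o) (ℚ.*-monoˡ-≤-nonNeg ((+ 2) / 3) (toℚ-mono-≤ 3≤o)) ⟩
      toℚ o ℚ.+ ((+ 2) / 3) ℚ.* toℚ o      ≡⟨ solve 1 (λ x → x :+ con ((+ 2) / 3) :* x := con ((+ 5) / 3) :* x) refl (toℚ o) ⟩
      ((+ 5) / 3) ℚ.* toℚ o                ≤⟨ ℚ.*-monoʳ-≤-nonNeg (toℚ o) {{toℚ-nonNeg o}} 5/3≤α ⟩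
      α ℚ.* toℚ o                          ∎
      where open ℚ.≤-Reasoning

    WithinBound⇒≤α* : ∀ b o → WithinBound α b o → toℚ b ℚ.≤ α ℚ.* toℚ o
    WithinBound⇒≤α* b o within = ℚ.≤-trans within (ℚ.⊔-lub (≤α* o)
      (ℚ.≤-trans (ℚ.+-monoʳ-≤ (α ℚ.* toℚ o) (ℚ.nonPositive⁻¹ _)) (ℚ.≤-reflexive (ℚ.+-identityʳ _))))

    WithinBound⇒+2≤α* : ∀ b o → 3 ℕ.≤ o → WithinBound α b o → toℚ (b ℕ.+ 2) ℚ.≤ α ℚ.* toℚ o
    WithinBound⇒+2≤α* b o 3≤o within rewrite toℚ-+ b 2 =
      ≤-2⇒+2≤ (ℚ.≤-trans within (ℚ.⊔-lub (+2≤⇒≤-2 {toℚ o} (+2≤α* o 3≤o)) ℚ.≤-refl))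

    sumFin-≤α* : ∀ {k} (t o : Fin k → ℕ) → (∀ i → toℚ (t i) ℚ.≤ α ℚ.* toℚ (o i)) →
      toℚ (sumFin t) ℚ.≤ α ℚ.* toℚ (sumFin o)
    sumFin-≤α* {zero}  t o _ = ℚ.≤-reflexive (sym (ℚ.*-zeroʳ α))
    sumFin-≤α* {suc k} t o t≤αo
      rewrite toℚ-+ (t zero) (sumFin (λ i → t (suc i))) | toℚ-+ (o zero) (sumFin (λ i → o (suc i)))
            | ℚ.*-distribˡ-+ α (toℚ (o zero)) (toℚ (sumFin (λ i → o (suc i)))) =
      ℚ.+-mono-≤ (t≤αo zero) (sumFin-≤α* (λ i → t (suc i)) (λ i → o (suc i)) (λ i → t≤αo (suc i)))

    WithinBound-glue : ∀ {k} (b o : Fin k → ℕ) i₁ i₂ → i₁ ≢ i₂ → 3 ℕ.≤ o i₁ → 3 ℕ.≤ o i₂ →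
      (∀ i → WithinBound α (b i) (o i)) → ∀ cS opt → cS ℕ.≤ 2 ℕ.+ sumFin b → sumFin o ℕ.≤ opt →
      WithinBound α cS opt
    WithinBound-glue {k} b o i₁ i₂ i₁≢i₂ 3≤o₁ 3≤o₂ within cS opt cS≤ Σo≤opt =
      ℚ.≤-trans (+2≤⇒≤-2 {toℚ cS} cS+2≤αopt) (ℚ.p≤q⊔p (toℚ opt) _)
      where
      slack : Fin k → ℕ
      slack i = if (i == i₁) ∨ (i == i₂) then 2 else 0

      slack-pair : slack i₁ ℕ.+ slack i₂ ≡ 4
      slack-pair rewrite ==-refl i₁ | ==-refl i₂ | ∨-zeroʳ (i₂ == i₁) = refl

      with-slack : ∀ i → toℚ (b i ℕ.+ slack i) ℚ.≤ α ℚ.* toℚ (o i)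
      with-slack i with i == i₁ in i≡i₁
      ... | true rewrite ==⇒≡ i≡i₁ = WithinBound⇒+2≤α* (b i₁) (o i₁) 3≤o₁ (within i₁)
      ... | false with i == i₂ in i≡i₂
      ...   | true rewrite ==⇒≡ i≡i₂ = WithinBound⇒+2≤α* (b i₂) (o i₂) 3≤o₂ (within i₂)
      ...   | false rewrite ℕ.+-identityʳ (b i) = WithinBound⇒≤α* (b i) (o i) (within i)

      cS+2≤ : cS ℕ.+ 2 ℕ.≤ sumFin (λ i → b i ℕ.+ slack i)
      cS+2≤ = begin
        cS ℕ.+ 2                    ≤⟨ ℕ.+-monoˡ-≤ 2 cS≤ ⟩
        2 ℕ.+ sumFin b ℕ.+ 2        ≡⟨ trans (cong (ℕ._+ 2) (ℕ.+-comm 2 (sumFin b))) (ℕ.+-assoc (sumFin b) 2 2) ⟩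
        sumFin b ℕ.+ 4              ≤⟨ ℕ.+-monoʳ-≤ (sumFin b) (ℕ.≤-trans (ℕ.≤-reflexive (sym slack-pair)) (sumFin-≥-pair slack i₁ i₂ i₁≢i₂)) ⟩
        sumFin b ℕ.+ sumFin slack   ≡⟨ sumFin-+ b slack ⟨
        sumFin (λ i → b i ℕ.+ slack i) ∎
        where open ℕ.≤-Reasoning

      cS+2≤αopt : toℚ cS ℚ.+ toℚ 2 ℚ.≤ α ℚ.* toℚ opt
      cS+2≤αopt = begin
        toℚ cS ℚ.+ toℚ 2                       ≡⟨ toℚ-+ cS 2 ⟨
        toℚ (cS ℕ.+ 2)                         ≤⟨ toℚ-mono-≤ cS+2≤ ⟩
        toℚ (sumFin (λ i → b i ℕ.+ slack i))   ≤⟨ sumFin-≤α* _ o with-slack ⟩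
        α ℚ.* toℚ (sumFin o)                   ≤⟨ ℚ.*-monoˡ-≤-nonNeg α (toℚ-mono-≤ Σo≤opt) ⟩
        α ℚ.* toℚ opt                          ∎
        where open ℚ.≤-Reasoning

open Bounds using (WithinBound-glue)

everything : ∀ {A : Set} → A → Bool
everything _ = true

module Contraction {n m : ℕ} (ends : Fin m → Fin n × Fin n)
                   (loopFree : ∀ g → proj₁ (ends g) ≢ proj₂ (ends g)) (e : Fin m) where

  open import Data.Nat using (_≤_)

  u v : Fin n
  u = proj₁ (ends e)
  v = proj₂ (ends e)

  M : View n m
  M = contract ends u v

  endsᴹ : Fin m → Fin n × Fin n
  endsᴹ = View.ends M

  -- definitionally the node map of contract
  φ : Fin n → Fin n
  φ x = if x == u then v else x

  v≢u : v ≢ u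
  v≢u v≡u = loopFree e (sym v≡u)

  V-M-intro : ∀ {x} → x ≢ u → V M x ≡ true
  V-M-intro x≢u = not-intro (==-false x≢u)

  V-M-≢u : ∀ {x} → V M x ≡ true → x ≢ u
  V-M-≢u {x} h refl with trans (sym (==-refl x)) (not-elim h)
  ... | ()

  φ-u : φ u ≡ v
  φ-u rewrite ==-refl u = refl

  φ-fixed : ∀ {x} → x ≢ u → φ x ≡ x
  φ-fixed x≢u rewrite ==-false x≢u = refl

  φ-≢u : ∀ x → φ x ≢ u
  φ-≢u x with x ≟ u
  ... | yes _   = v≢u
  ... | no x≢u = x≢u

  V-M-φ : ∀ x → V M (φ x) ≡ true
  V-M-φ x = V-M-intro (φ-≢u x)

  φ-onto-v : ∀ {x} → φ x ≡ v → (x ≡ u) ⊎ (x ≡ v)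
  φ-onto-v {x} φx≡v with x ≟ u
  ... | yes x≡u = inj₁ x≡u
  ... | no _    = inj₂ φx≡v

  φ-collapse : ∀ {a b} → φ a ≡ φ b → a ≢ b → (a ≡ u) ⊎ (a ≡ v)
  φ-collapse {a} {b} φa≡φb a≢b with a ≟ u | b ≟ u
  ... | yes a≡u | _       = inj₁ a≡u
  ... | no _    | yes refl = inj₂ φa≡φb
  ... | no _    | no _     = ⊥-elim (a≢b φa≡φb)

  isUV⇒φ-loop : ∀ a b → isUV u v (a , b) ≡ true → φ a ≡ φ b
  isUV⇒φ-loop a b uv with ∨-elim {(a == u) ∧ (b == v)} uv
  ... | inj₁ h with ==⇒≡ {x = a} {u} (∧-elimˡ h) | ==⇒≡ {x = b} {v} (∧-elimʳ {a == u} h)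
  ...   | refl | refl = trans φ-u (sym (φ-fixed v≢u))
  isUV⇒φ-loop a b uv | inj₂ h with ==⇒≡ {x = a} {v} (∧-elimˡ h) | ==⇒≡ {x = b} {u} (∧-elimʳ {a == v} h)
  ...   | refl | refl = trans (φ-fixed v≢u) (sym φ-u)

  φ-loop-at-v⇒isUV : ∀ {a b} → a ≢ b → φ a ≡ v → φ b ≡ v → isUV u v (a , b) ≡ true
  φ-loop-at-v⇒isUV {a} {b} a≢b φa≡v φb≡v with φ-onto-v {a} φa≡v | φ-onto-v {b} φb≡v
  ... | inj₁ refl | inj₁ refl = ⊥-elim (a≢b refl)
  ... | inj₂ refl | inj₂ refl = ⊥-elim (a≢b refl)
  ... | inj₁ refl | inj₂ refl rewrite ==-refl u | ==-refl v = refl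
  ... | inj₂ refl | inj₁ refl rewrite ==-refl u | ==-refl v | ==-false v≢u = refl

  E-M-no-loop-at-v : ∀ g → E M g ≡ true → φ (proj₁ (ends g)) ≡ v → φ (proj₂ (ends g)) ≡ v → ⊥
  E-M-no-loop-at-v g g∈M φ₁≡v φ₂≡v
    with trans (sym (cong not (φ-loop-at-v⇒isUV (loopFree g) φ₁≡v φ₂≡v))) g∈M
  ... | ()

  E-M-e : E M e ≡ false
  E-M-e rewrite ==-refl u | ==-refl v = refl

  Step-contract : ∀ {F a b} → Step ends everything F a b → Reach endsᴹ (V M) (λ g → F g ∧ E M g) (φ a) (φ b)
  Step-contract {F} (fwd g f _ _) with isUV u v (ends g) in uv
  ... | true  = subst (Reach endsᴹ (V M) (λ g → F g ∧ E M g) (φ (proj₁ (ends g))))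
                      (isUV⇒φ-loop (proj₁ (ends g)) (proj₂ (ends g)) uv) ε
  ... | false = fwd g (∧-intro f (not-intro uv)) (V-M-φ (proj₁ (ends g))) (V-M-φ (proj₂ (ends g))) ◅ ε
  Step-contract {F} (bwd g f _ _) with isUV u v (ends g) in uv
  ... | true  = subst (Reach endsᴹ (V M) (λ g → F g ∧ E M g) (φ (proj₂ (ends g))))
                      (sym (isUV⇒φ-loop (proj₁ (ends g)) (proj₂ (ends g)) uv)) ε
  ... | false = bwd g (∧-intro f (not-intro uv)) (V-M-φ (proj₁ (ends g))) (V-M-φ (proj₂ (ends g))) ◅ ε

  Reach-contract : ∀ {F a b} → Reach ends everything F a b → Reach endsᴹ (V M) (λ g → F g ∧ E M g) (φ a) (φ b)
  Reach-contract = Star.kleisliStar φ Step-contract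

  module Lift (F : Fin m → Bool) where

    ReachesUV : Fin n → Set
    ReachesUV a = Reach ends everything F a u ⊎ Reach ends everything F a v

    ReachesUV-base : ∀ {a} → (a ≡ u) ⊎ (a ≡ v) → ReachesUV a
    ReachesUV-base (inj₁ refl) = inj₁ ε
    ReachesUV-base (inj₂ refl) = inj₂ ε

    ReachesUV-◅◅ : ∀ {a b} → Reach ends everything F a b → ReachesUV b → ReachesUV a
    ReachesUV-◅◅ p (inj₁ q) = inj₁ (p ◅◅ q)
    ReachesUV-◅◅ p (inj₂ q) = inj₂ (p ◅◅ q)

    -- The walk is lifted edge by edge; the lift breaks only where φ identifies two nodes, that is at u or v.
    Reach-lift-to-uv : ∀ {W F′ X} → F′ ⊆ F → Reach endsᴹ W F′ X v → ∀ a → φ a ≡ X → ReachesUV a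
    Reach-lift-to-uv F′⊆F ε a φa≡v = ReachesUV-base (φ-onto-v φa≡v)
    Reach-lift-to-uv F′⊆F (fwd g f _ _ ◅ p) a φa≡φ₁ with a ≟ proj₁ (ends g)
    ... | yes refl = ReachesUV-◅◅ (fwd g (F′⊆F g f) refl refl ◅ ε) (Reach-lift-to-uv F′⊆F p _ refl)
    ... | no a≢₁   = ReachesUV-base (φ-collapse φa≡φ₁ a≢₁)
    Reach-lift-to-uv F′⊆F (bwd g f _ _ ◅ p) a φa≡φ₂ with a ≟ proj₂ (ends g)
    ... | yes refl = ReachesUV-◅◅ (bwd g (F′⊆F g f) refl refl ◅ ε) (Reach-lift-to-uv F′⊆F p _ refl)
    ... | no a≢₂   = ReachesUV-base (φ-collapse φa≡φ₂ a≢₂)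

    module _ (e∈F : F e ≡ true) where

      Reach-φ : ∀ a → Reach ends everything F a (φ a)
      Reach-φ a with a ≟ u
      ... | yes refl = fwd e e∈F refl refl ◅ ε
      ... | no _     = ε

      Step-lift : ∀ {W F′ a b} → F′ ⊆ F → Step endsᴹ W F′ a b → Reach ends everything F a b
      Step-lift F′⊆F (fwd g f _ _) =
        Reach-sym (Reach-φ (proj₁ (ends g))) ◅◅ fwd g (F′⊆F g f) refl refl ◅ Reach-φ (proj₂ (ends g))
      Step-lift F′⊆F (bwd g f _ _) =
        Reach-sym (Reach-φ (proj₂ (ends g))) ◅◅ bwd g (F′⊆F g f) refl refl ◅ Reach-φ (proj₁ (ends g))

      Reach-lift : ∀ {W F′ a b} → F′ ⊆ F → Reach endsᴹ W F′ a b → Reach ends everything F a b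
      Reach-lift F′⊆F = Star.fold _ (λ s p → Step-lift F′⊆F s ◅◅ p) ε

  module Component (C : Fin n → Bool) (isC : IsComponent M v C) where

    root : Fin n
    root = proj₁ isC

    reach⇒C : ∀ {x} → Reach endsᴹ (delV (V M) v) (E M) root x → C x ≡ true
    reach⇒C {x} = proj₂ (proj₂ (proj₂ isC) x)

    C⇒reach : ∀ {x} → C x ≡ true → Reach endsᴹ (delV (V M) v) (E M) root x
    C⇒reach {x} = proj₁ (proj₂ (proj₂ isC) x)

    C⊆M-v : ∀ {x} → C x ≡ true → delV (V M) v x ≡ true
    C⊆M-v x∈C = Reach-inside (C⇒reach x∈C) (proj₁ (proj₂ isC))

    B : View n m
    B = block M v C

    v∈B : V B v ≡ true
    v∈B = ∧-intro (V-M-intro v≢u) (∨-introˡ (C v) (==-refl v))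

    C⊆B : ∀ {x} → C x ≡ true → V B x ≡ true
    C⊆B {x} x∈C = ∧-intro (delV-⊆ (V M) v x (C⊆M-v x∈C)) (∨-introʳ (x == v) x∈C)

    root∈C : C root ≡ true
    root∈C = reach⇒C ε

    B-cases : ∀ {x} → V B x ≡ true → (x ≡ v) ⊎ (C x ≡ true)
    B-cases {x} x∈B with ∨-elim {x == v} (∧-elimʳ {V M x} x∈B)
    ... | inj₁ x≡v = inj₁ (==⇒≡ x≡v)
    ... | inj₂ x∈C = inj₂ x∈C

    -- C is a component of M - v, so the only way out of B is through v.
    leaves-only-at-v : ∀ {F a b} → F ⊆ E M → V B a ≡ true → Step endsᴹ (V M) F a b → V B b ≡ false → a ≡ v
    leaves-only-at-v {F} {a} {b} F⊆EM a∈B s b∉B with B-cases a∈B | b ≟ v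
    ... | inj₁ a≡v | _        = a≡v
    ... | inj₂ _   | yes refl with trans (sym v∈B) b∉B
    ...   | ()
    leaves-only-at-v {F} {a} {b} F⊆EM a∈B s b∉B | inj₂ a∈C | no b≢v
      with trans (sym (C⊆B (reach⇒C (C⇒reach a∈C ◅◅ Step-within F⊆EM a∈M-v b∈M-v s ◅ ε)))) b∉B
      where
      a∈M-v : delV (V M) v a ≡ true
      a∈M-v = C⊆M-v a∈C
      b∈M-v : delV (V M) v b ≡ true
      b∈M-v = delV-intro {W = V M} (proj₂ (Step-inside s)) b≢v
    ...   | ()

    Reach-into-B : ∀ {F a y} → F ⊆ E M → Reach endsᴹ (V M) F a y → V B y ≡ true →
      (V B a ≡ true → Reach endsᴹ (V B) F a y) × (V B a ≡ false → Reach endsᴹ (V B) F v y)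
    Reach-into-B F⊆EM ε y∈B = (λ _ → ε) , λ y∉B → contradiction (trans (sym y∈B) y∉B) λ ()
    Reach-into-B {F} {a} {y} F⊆EM (_◅_ {j = b} s p) y∈B
      with Reach-into-B F⊆EM p y∈B | V B a in a∈B | V B b in b∈B
    ... | from-b , _ | true  | true  = (λ _ → Step-within (λ _ f → f) a∈B b∈B s ◅ from-b b∈B) , λ ()
    ... | _ , from-v | true  | false =
      (λ _ → subst (λ z → Reach endsᴹ (V B) F z y) (sym (leaves-only-at-v F⊆EM a∈B s b∈B)) (from-v b∈B)) , λ ()
    ... | from-b , _ | false | true  =
      (λ ()) , λ _ → subst (λ z → Reach endsᴹ (V B) F z y) (leaves-only-at-v F⊆EM b∈B (Step-sym s) a∈B) (from-b b∈B)
    ... | _ , from-v | false | false = (λ ()) , λ _ → from-v b∈B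

    restrict : (Fin m → Bool) → Fin m → Bool
    restrict H g = H g ∧ E B g

    restrict-ECSS : ∀ H → IsECSS (whole ends) H → IsECSS B (restrict H)
    restrict-ECSS H (_ , twoEC-H) =
      (λ g → ∧-elimʳ {H g}) , (v , root , (λ v≡root → C-≢v root∈C (sym v≡root)) , v∈B , C⊆B root∈C) ,
      (λ x y x∈B y∈B → Reach-monoᴱ (λ g → delE-⊆ (restrict H) e g) (without e x y x∈B y∈B)) ,
      (λ g _ → without g)
      where
      C-≢v : ∀ {x} → C x ≡ true → x ≢ v
      C-≢v x∈C = delV-≢ {W = V M} (C⊆M-v x∈C)
      without : ∀ g → Connected endsᴹ (V B) (delE (restrict H) g)
      without g x y x∈B y∈B = Reach-mono (λ _ w → w) back-to-H inB
        where
        F : Fin m → Bool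
        F g′ = delE H g g′ ∧ E M g′
        fixed : ∀ {z} → V B z ≡ true → φ z ≡ z
        fixed {z} z∈B = φ-fixed (V-M-≢u (∧-elimˡ {V M z} z∈B))
        inM : Reach endsᴹ (V M) F x y
        inM = subst₂ (Reach endsᴹ (V M) F) (fixed x∈B) (fixed y∈B)
                (Reach-contract (TwoEC-delE-connected twoEC-H g x y refl refl))
        inB : Reach endsᴹ (V B) F x y
        inB = proj₁ (Reach-into-B (λ g′ → ∧-elimʳ {delE H g g′}) inM y∈B) x∈B
        back-to-H : EdgesWithin endsᴹ (V B) F (delE (restrict H) g)
        back-to-H g′ f w₁ w₂ = delE-intro {F = restrict H}
          (∧-intro (delE-⊆ H g g′ g′∈H-g) (∧-intro (∧-elimʳ {delE H g g′} f)
            (∧-intro (∧-elimʳ {V M (proj₁ (endsᴹ g′))} w₁) (∧-elimʳ {V M (proj₂ (endsᴹ g′))} w₂))))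
          (delE-≢ {F = H} g′∈H-g)
          where
          g′∈H-g : delE H g g′ ≡ true
          g′∈H-g = ∧-elimˡ {delE H g g′} f

  components-≗ : ∀ {C₁ C₂} → IsComponent M v C₁ → IsComponent M v C₂ →
    ∀ {x} → C₁ x ≡ true → C₂ x ≡ true → ∀ y → C₁ y ≡ C₂ y
  components-≗ {C₁} {C₂} isC₁ isC₂ x∈C₁ x∈C₂ y = Bool-ext
    (λ y∈C₁ → K₂.reach⇒C (K₂.C⇒reach x∈C₂ ◅◅ Reach-sym (K₁.C⇒reach x∈C₁) ◅◅ K₁.C⇒reach y∈C₁))
    (λ y∈C₂ → K₁.reach⇒C (K₁.C⇒reach x∈C₁ ◅◅ Reach-sym (K₂.C⇒reach x∈C₂) ◅◅ K₂.C⇒reach y∈C₂))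
    where
    module K₁ = Component C₁ isC₁
    module K₂ = Component C₂ isC₂

  block-edges-disjoint : ∀ {C₁ C₂} → IsComponent M v C₁ → IsComponent M v C₂ → ¬ (∀ y → C₁ y ≡ C₂ y) →
    ∀ g → E (block M v C₁) g ≡ true → E (block M v C₂) g ≡ true → ⊥
  block-edges-disjoint {C₁} {C₂} isC₁ isC₂ C₁≉C₂ g g∈B₁ g∈B₂ = E-M-no-loop-at-v g (∧-elimˡ g∈B₁)
    (shared (∧-elimˡ {in₁ x₁} (∧-elimʳ {E M g} g∈B₁)) (∧-elimˡ {in₂ x₁} (∧-elimʳ {E M g} g∈B₂)))
    (shared (∧-elimʳ {in₁ x₁} (∧-elimʳ {E M g} g∈B₁)) (∧-elimʳ {in₂ x₁} (∧-elimʳ {E M g} g∈B₂)))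
    where
    x₁ : Fin n
    x₁ = φ (proj₁ (ends g))
    in₁ in₂ : Fin n → Bool
    in₁ x = (x == v) ∨ C₁ x
    in₂ x = (x == v) ∨ C₂ x
    shared : ∀ {x} → in₁ x ≡ true → in₂ x ≡ true → x ≡ v
    shared {x} x∈₁ x∈₂ with ∨-elim {x == v} x∈₁ | ∨-elim {x == v} x∈₂
    ... | inj₁ x≡v | _        = ==⇒≡ x≡v
    ... | inj₂ _   | inj₁ x≡v = ==⇒≡ x≡v
    ... | inj₂ x∈C₁ | inj₂ x∈C₂ = ⊥-elim (C₁≉C₂ (components-≗ isC₁ isC₂ x∈C₁ x∈C₂))

  IsECSS-block-≗ : ∀ {C C′} → (∀ x → C x ≡ C′ x) → ∀ S → IsECSS (block M v C′) S → IsECSS (block M v C) S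
  IsECSS-block-≗ {C} {C′} C≗C′ S (S⊆B′ , (x , y , x≢y , x∈B′ , y∈B′) , connected , bridgeless) =
    (λ g g∈S → subst (_≡ true) (sym (E-≗ g)) (S⊆B′ g g∈S)) ,
    (x , y , x≢y , V-≗⇐ x x∈B′ , V-≗⇐ y y∈B′) ,
    (λ a b a∈B b∈B → relocate (connected a b (V-≗⇒ a a∈B) (V-≗⇒ b b∈B))) ,
    (λ g g∈S a b a∈B b∈B → relocate (bridgeless g g∈S a b (V-≗⇒ a a∈B) (V-≗⇒ b b∈B)))
    where
    V-≗ : ∀ x → V (block M v C) x ≡ V (block M v C′) x
    V-≗ x = cong (λ b → V M x ∧ ((x == v) ∨ b)) (C≗C′ x)
    E-≗ : ∀ g → E (block M v C) g ≡ E (block M v C′) g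
    E-≗ g = cong₂ (λ b₁ b₂ → E M g ∧ ((φ (proj₁ (ends g)) == v) ∨ b₁) ∧ ((φ (proj₂ (ends g)) == v) ∨ b₂))
                  (C≗C′ _) (C≗C′ _)
    V-≗⇐ : V (block M v C′) ⊆ V (block M v C)
    V-≗⇐ x = trans (V-≗ x)
    V-≗⇒ : V (block M v C) ⊆ V (block M v C′)
    V-≗⇒ x = trans (sym (V-≗ x))
    relocate : ∀ {F a b} → Reach endsᴹ (V (block M v C′)) F a b → Reach endsᴹ (V (block M v C)) F a b
    relocate = Reach-mono V-≗⇐ (λ _ f _ _ → f)

  module Augmentation {k} (Cs : Fin k → Fin n → Bool) (isCs : ∀ i → IsComponent M v (Cs i))
    (complete : ∀ C → IsComponent M v C → ∃[ i ] (∀ x → C x ≡ Cs i x))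
    (B′ : Fin k → Fin m → Bool) (B′-ECSS : ∀ i → IsECSS (block M v (Cs i)) (B′ i)) where

    U : Fin m → Bool
    U g = anyFin (λ i → B′ i g)

    S : Fin m → Fin m → Bool
    S f g = (g == e) ∨ (g == f) ∨ U g

    e∈S : ∀ f → S f e ≡ true
    e∈S f = ∨-introˡ _ (==-refl e)

    f∈S : ∀ f → S f f ≡ true
    f∈S f = ∨-introʳ (f == e) (∨-introˡ _ (==-refl f))

    e∈S-g : ∀ f g → g ≢ e → delE (S f) g e ≡ true
    e∈S-g f g g≢e = delE-intro {F = S f} (e∈S f) λ e≡g → g≢e (sym e≡g)

    f∈S-e : ∀ f → f ≢ e → delE (S f) e f ≡ true
    f∈S-e f f≢e = delE-intro {F = S f} (f∈S f) f≢e

    U⊆S : ∀ f → U ⊆ S f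
    U⊆S f g g∈U = ∨-introʳ (g == e) (∨-introʳ (g == f) g∈U)

    e∉U : U e ≡ false
    e∉U with U e in e∈U
    ... | false = refl
    ... | true with anyFin-elim (λ i → B′ i e) e∈U
    ...   | i , e∈B′ with trans (sym (∧-elimˡ (proj₁ (B′-ECSS i) e e∈B′))) E-M-e
    ...     | ()

    U⊆S-e : ∀ f → U ⊆ delE (S f) e
    U⊆S-e f g g∈U = delE-intro {F = S f} {g = g} (U⊆S f g g∈U) λ { refl → contradiction (trans (sym g∈U) e∉U) λ () }

    block-of : ∀ x → x ≢ u → x ≢ v → ∃[ i ] (V (block M v (Cs i)) x ≡ true)
    block-of x x≢u x≢v = i , Component.C⊆B (Cs i) (isCs i) (subst (_≡ true) (C≗Cs x) (⌊⌋-complete (reach? x) ε))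
      where
      reach? : ∀ y → Dec (Reach endsᴹ (delV (V M) v) (E M) x y)
      reach? = Reach? endsᴹ (delV (V M) v) (E M) x
      Cx : Fin n → Bool
      Cx y = ⌊ reach? y ⌋
      isCx : IsComponent M v Cx
      isCx = x , delV-intro {W = V M} (V-M-intro x≢u) x≢v , λ y → ⌊⌋-sound (reach? y) , ⌊⌋-complete (reach? y)
      i : Fin k
      i = proj₁ (complete Cx isCx)
      C≗Cs : ∀ y → Cx y ≡ Cs i y
      C≗Cs = proj₂ (complete Cx isCx)

    reach-v-in-block : ∀ g x → x ≢ u → (x ≡ v) ⊎ ∃[ i ] Reach endsᴹ (V (block M v (Cs i))) (delE (B′ i) g) x v
    reach-v-in-block g x x≢u with x ≟ v
    ... | yes x≡v = inj₁ x≡v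
    ... | no x≢v with block-of x x≢u x≢v
    ...   | i , x∈B = inj₂ (i , TwoEC-delE-connected (proj₂ (B′-ECSS i)) g x v x∈B
                                   (Component.v∈B (Cs i) (isCs i)))

    hub-v : ∀ f g → g ≢ e → ∀ x → Reach ends everything (delE (S f) g) x v
    hub-v f g g≢e x with x ≟ u
    ... | yes refl = fwd e (e∈S-g f g g≢e) refl refl ◅ ε
    ... | no x≢u with reach-v-in-block g x x≢u
    ...   | inj₁ refl    = ε
    ...   | inj₂ (i , p) = Lift.Reach-lift (delE (S f) g) (e∈S-g f g g≢e) B′⊆ p
      where
      B′⊆ : delE (B′ i) g ⊆ delE (S f) g
      B′⊆ g′ g′∈B′ = delE-intro {F = S f} (U⊆S f g′ (anyFin-intro (λ i → B′ i g′) i (delE-⊆ (B′ i) g g′ g′∈B′)))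
                                          (delE-≢ {F = B′ i} g′∈B′)

    reaches-u-or-v : ∀ x → Lift.ReachesUV U x
    reaches-u-or-v x with x ≟ u
    ... | yes x≡u = Lift.ReachesUV-base U (inj₁ x≡u)
    ... | no x≢u with reach-v-in-block e x x≢u
    ...   | inj₁ x≡v     = Lift.ReachesUV-base U (inj₂ x≡v)
    ...   | inj₂ (i , p) = Lift.Reach-lift-to-uv U B′⊆U p x (φ-fixed x≢u)
      where
      B′⊆U : delE (B′ i) e ⊆ U
      B′⊆U g g∈B′ = anyFin-intro (λ i → B′ i g) i (delE-⊆ (B′ i) e g g∈B′)

    ReachesU : Fin n → Set
    ReachesU a = Reach ends everything U a u

    Crossing : Fin m → Set
    Crossing f = f ≢ e × ((ReachesU (proj₁ (ends f)) × ¬ ReachesU (proj₂ (ends f)))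
                          ⊎ (ReachesU (proj₂ (ends f)) × ¬ ReachesU (proj₁ (ends f))))

    crossing : ∀ {a b} → Reach ends everything (delE everything e) a b → ReachesU a → ¬ ReachesU b → ∃[ f ] Crossing f
    crossing ε a→u ¬b→u = ⊥-elim (¬b→u a→u)
    crossing (_◅_ {j = b} s p) a→u ¬c→u with Reach? ends everything U b u
    ... | yes b→u = crossing p b→u ¬c→u
    ... | no ¬b→u with s
    ...   | fwd f f≢e _ _ = f , delE-≢ {F = everything} f≢e , inj₁ (a→u , ¬b→u)
    ...   | bwd f f≢e _ _ = f , delE-≢ {F = everything} f≢e , inj₂ (a→u , ¬b→u)

    Crossing⇒v→u : ∀ f → Crossing f → Reach ends everything (delE (S f) e) v u
    Crossing⇒v→u f (f≢e , inj₁ (₁→u , ¬₂→u)) with reaches-u-or-v (proj₂ (ends f))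
    ... | inj₁ ₂→u = ⊥-elim (¬₂→u ₂→u)
    ... | inj₂ ₂→v =
      Reach-sym (Reach-monoᴱ (U⊆S-e f) ₂→v) ◅◅ bwd f (f∈S-e f f≢e) refl refl ◅ Reach-monoᴱ (U⊆S-e f) ₁→u
    Crossing⇒v→u f (f≢e , inj₂ (₂→u , ¬₁→u)) with reaches-u-or-v (proj₁ (ends f))
    ... | inj₁ ₁→u = ⊥-elim (¬₁→u ₁→u)
    ... | inj₂ ₁→v =
      Reach-sym (Reach-monoᴱ (U⊆S-e f) ₁→v) ◅◅ fwd f (f∈S-e f f≢e) refl refl ◅ Reach-monoᴱ (U⊆S-e f) ₂→u

    hub-u : ∀ f → Reach ends everything (delE (S f) e) v u → ∀ x → Reach ends everything (delE (S f) e) x u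
    hub-u f v→u x with reaches-u-or-v x
    ... | inj₁ x→u = Reach-monoᴱ (U⊆S-e f) x→u
    ... | inj₂ x→v = Reach-monoᴱ (U⊆S-e f) x→v ◅◅ v→u

    S-is-ECSS : ∀ f → Reach ends everything (delE (S f) e) v u → IsECSS (whole ends) (S f)
    S-is-ECSS f v→u = (λ _ _ → refl) , (u , v , loopFree e , refl , refl) ,
      (λ x y _ _ → Reach-monoᴱ (delE-⊆ (S f) e) (Connected-hub u (λ x _ → hub-u f v→u x) x y refl refl)) ,
      bridgeless
      where
      bridgeless : ∀ g → S f g ≡ true → Connected ends everything (delE (S f) g)
      bridgeless g _ with g ≟ e
      ... | yes refl = Connected-hub u λ x _ → hub-u f v→u x
      ... | no g≢e   = Connected-hub v λ x _ → hub-v f g g≢e x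

    ∃-ECSS : TwoEC ends everything everything → ∃[ f ] IsECSS (whole ends) (S f)
    ∃-ECSS (_ , _ , bridgeless) with Reach? ends everything U v u
    ... | yes v→u = e , S-is-ECSS e (Reach-monoᴱ (U⊆S-e e) v→u)
    ... | no ¬v→u with crossing (bridgeless e refl u v refl refl) ε ¬v→u
    ...   | f , f-crosses = f , S-is-ECSS f (Crossing⇒v→u f f-crosses)

    cost-S : ∀ (c : Fin m → ℕ) f → c e ≡ 1 → c f ≤ 1 → cost c (S f) ≤ 2 + sumFin (λ i → cost c (B′ i))
    cost-S c f c-e≡1 c-f≤1 = begin
      cost c (S f)                                                    ≤⟨ cost-∨ c (_== e) (λ g → (g == f) ∨ U g) ⟩
      cost c (_== e) + cost c (λ g → (g == f) ∨ U g)                  ≤⟨ ℕ.+-monoʳ-≤ (cost c (_== e)) (cost-∨ c (_== f) U) ⟩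
      cost c (_== e) + (cost c (_== f) + cost c U)                    ≤⟨ ℕ.+-mono-≤ e-part (ℕ.+-mono-≤ f-part (cost-anyFin c B′)) ⟩
      1 + (1 + sumFin (λ i → cost c (B′ i)))                          ≡⟨ ℕ.+-assoc 1 1 _ ⟨
      2 + sumFin (λ i → cost c (B′ i))                                ∎
      where
      open ℕ.≤-Reasoning
      e-part : cost c (_== e) ≤ 1
      e-part = ℕ.≤-trans (cost-singleton c e) (ℕ.≤-reflexive c-e≡1)
      f-part : cost c (_== f) ≤ 1
      f-part = ℕ.≤-trans (cost-singleton c f) c-f≤1

  module _ {k} (c : Fin m → ℕ) (Cs : Fin k → Fin n → Bool) (isCs : ∀ i → IsComponent M v (Cs i))
    (Cs-injective : ∀ i j → (∀ x → Cs i x ≡ Cs j x) → i ≡ j) where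

    sumFin-opt-blocks-≤ : ∀ H → IsECSS (whole ends) H → (o : Fin k → ℕ) → (∀ i → IsOpt c (block M v (Cs i)) (o i)) →
      sumFin o ≤ cost c H
    sumFin-opt-blocks-≤ H H-ECSS o isOpt = ℕ.≤-trans
      (sumFin-mono-≤ λ i → proj₂ (isOpt i) (Hᵢ i) (Component.restrict-ECSS (Cs i) (isCs i) H H-ECSS))
      (sumFin-cost-disjoint c Hᵢ H (λ i g → ∧-elimˡ {H g}) disjoint)
      where
      Hᵢ : Fin k → Fin m → Bool
      Hᵢ i = Component.restrict (Cs i) (isCs i) H
      disjoint : ∀ i j g → i ≢ j → Hᵢ i g ≡ true → Hᵢ j g ≡ true → ⊥
      disjoint i j g i≢j g∈Hᵢ g∈Hⱼ = block-edges-disjoint (isCs i) (isCs j) (λ Csᵢ≗Csⱼ → i≢j (Cs-injective i j Csᵢ≗Csⱼ))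
                                       g (∧-elimʳ {H g} g∈Hᵢ) (∧-elimʳ {H g} g∈Hⱼ)

  IsOpt-block-≗ : ∀ (c : Fin m → ℕ) {C C′ o o′} → (∀ x → C x ≡ C′ x) →
    IsOpt c (block M v C) o → IsOpt c (block M v C′) o′ → o ≤ o′
  IsOpt-block-≗ c C≗C′ (_ , least) ((S′ , S′-ECSS , refl) , _) = least S′ (IsECSS-block-≗ C≗C′ S′ S′-ECSS)

open import Data.Integer using (+_)
open import Data.Rational using (ℚ; _≤_; _/_)
import Data.Rational.Properties as ℚ
open import Relation.Nullary.Negation using (¬¬-map)
open import Relation.Nullary.Decidable using (decidable-stable)

IsMAP-cost≤1 : ∀ {n m} {ends : Fin m → Fin n × Fin n} {c : Fin m → ℕ} → IsMAP ends c → ∀ g → c g ℕ.≤ 1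
IsMAP-cost≤1 {c = c} isMAP g with IsMAP.costs01 isMAP g
... | inj₁ c-g≡0 = ℕ.≤-trans (ℕ.≤-reflexive c-g≡0) ℕ.z≤n
... | inj₂ c-g≡1 = ℕ.≤-reflexive c-g≡1

lemma17 : (α : ℚ) → ((+ 5) / 3) ≤ α →
    {n m : ℕ} (ends : Fin m → Fin n × Fin n) (c : Fin m → ℕ) →
    IsMAP ends c →
    TwoNC ends (λ _ → true) (λ _ → true) →
    (e : Fin m) → IsUnitS2 ends c e →
    let M = contract ends (proj₁ (ends e)) (proj₂ (ends e))
        v̂ = proj₂ (ends e)
    in
    (k : ℕ) (Cs : Fin k → (Fin n → Bool)) →
    (∀ i → IsComponent M v̂ (Cs i)) →
    (∀ i j → (∀ x → Cs i x ≡ Cs j x) → i ≡ j) →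
    (∀ C → IsComponent M v̂ C → ∃[ i ] (∀ x → C x ≡ Cs i x)) →
    (B' : Fin k → (Fin m → Bool)) →
    (∀ i → IsECSS (block M v̂ (Cs i)) (B' i)) →
    (∀ i o → IsOpt c (block M v̂ (Cs i)) o → WithinBound α (cost c (B' i)) o) →
    ∃[ f ] (let S = λ g → (g == e) ∨ (g == f) ∨ anyFin (λ i → B' i g)
            in IsECSS (whole ends) S
               × (∀ o → IsOpt c (whole ends) o → WithinBound α (cost c S) o))
lemma17 α 5/3≤α {n} {m} ends c isMAP _ e (c-e≡1 , _ , C₁ , C₂ , isC₁ , isC₂ , x , C₁x≢C₂x , (big₁ , _) , (big₂ , _))
        k Cs isCs Cs-injective complete B′ B′-ECSS B′-bound = f , S-ECSS , bound
  where
  open IsMAP isMAP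
  open Contraction ends loopFree e
  open Augmentation Cs isCs complete B′ B′-ECSS

  f : Fin m
  f = proj₁ (∃-ECSS twoEC)

  S-ECSS : IsECSS (whole ends) (S f)
  S-ECSS = proj₂ (∃-ECSS twoEC)

  i₁ i₂ : Fin k
  i₁ = proj₁ (complete C₁ isC₁)
  i₂ = proj₁ (complete C₂ isC₂)

  i₁≢i₂ : i₁ ≢ i₂
  i₁≢i₂ i₁≡i₂ = C₁x≢C₂x (begin
    C₁ x     ≡⟨ proj₂ (complete C₁ isC₁) x ⟩
    Cs i₁ x  ≡⟨ cong (λ i → Cs i x) i₁≡i₂ ⟩
    Cs i₂ x  ≡⟨ proj₂ (complete C₂ isC₂) x ⟨
    C₂ x     ∎)
    where open ≡-Reasoning

  module _ (opt : ∀ i → ∃[ oᵢ ] IsOpt c (block M v (Cs i)) oᵢ) where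

    ≥3 : ∀ {C i} → ∃[ o′ ] (IsOpt c (block M v C) o′ × 3 ℕ.≤ o′) → (∀ x → C x ≡ Cs i x) → 3 ℕ.≤ proj₁ (opt i)
    ≥3 {i = i} (o′ , isOpt′ , 3≤o′) C≗Csᵢ = ℕ.≤-trans 3≤o′ (IsOpt-block-≗ c C≗Csᵢ isOpt′ (proj₂ (opt i)))

    bound-from-blocks : ∀ H → IsECSS (whole ends) H → WithinBound α (cost c (S f)) (cost c H)
    bound-from-blocks H H-ECSS = WithinBound-glue α 5/3≤α (λ i → cost c (B′ i)) (λ i → proj₁ (opt i)) i₁ i₂ i₁≢i₂
      (≥3 big₁ (proj₂ (complete C₁ isC₁))) (≥3 big₂ (proj₂ (complete C₂ isC₂))) (λ i → B′-bound i _ (proj₂ (opt i)))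
      (cost c (S f)) (cost c H) (cost-S c f c-e≡1 (IsMAP-cost≤1 isMAP f))
      (sumFin-opt-blocks-≤ c Cs isCs Cs-injective H H-ECSS (λ i → proj₁ (opt i)) (λ i → proj₂ (opt i)))

  bound : ∀ o → IsOpt c (whole ends) o → WithinBound α (cost c (S f)) o
  bound o ((H , H-ECSS , refl) , _) = decidable-stable (_ ℚ.≤? _)
    (¬¬-map (λ opt → bound-from-blocks opt H H-ECSS) (¬¬-Π-Fin _ λ i → ¬¬-opt c _ (B′ i) (B′-ECSS i)))
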